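{- Let $T$ be an unrooted binary phylogenetic $X$-tree and $U$ a $3$-cuttable unrooted binary phylogenetic network on $X$ that is not simple. Let $e=\{u,v\}$ be a non-trivial cut-edge of $U$, inducing the split $X_1|X_2$, where $u$ lies on the side containing $X_1$, and suppose $T$ has an edge $e'=\{u',v'\}$ inducing the same split $X_1|X_2$, with $u'$ on the side containing $X_1$. Let $x_1,x_2\notin X$ be new leaves. Let $U_1$ (resp. $U_2$) be the connected component of $U-e$ containing $u$ (resp. $v$) together with a new edge $\{u,x_1\}$ (resp. $\{v,x_2\}$), and let $T_1$ (resp. $T_2$) be the component of $T-e'$ containing $u'$ (resp. $v'$) together with a new edge $\{u',x_1\}$ (resp. $\{v',x_2\}$); so $T_1,U_1$ have leaf set $X_1\cup\{x_1\}$ and $T_2,U_2$ have leaf set $X_2\cup\{x_2\}$. Then $U$ displays $T$ if and only if $U_1$ displays $T_1$ and $U_2$ displays $T_2$.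
   Context: An unrooted binary phylogenetic network on a non-empty finite set $X$ is a simple connected undirected graph whose internal vertices have degree $3$ and whose degree-$1$ vertices (leaves) are bijectively labeled by $X$; an unrooted binary phylogenetic $X$-tree is such a network that is a tree. A cut-edge is an edge whose deletion disconnects the graph; it is trivial if one of its endpoints is a leaf. $U$ is simple if every cut-edge is incident to a leaf. $U$ is $3$-cuttable if every cycle contains a path of at least $3$ vertices each incident to a cut-edge. An edge $e$ induces the split $X_1|X_2$ (a partition of $X$ into non-empty parts) if every path between a leaf of $X_1$ and a leaf of $X_2$ passes through $e$. $U$ displays $T$ if some subgraph of $U$ is a subdivision of $T$. -}

module Defs where

open import Data.Nat using (ℕ; _≤_)
open import Data.Fin using (Fin)
open import Data.List using (List; []; _∷_; _++_; length; take)
open import Data.List.Membership.Propositional using (_∈_)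
open import Data.List.Relation.Unary.Unique.Propositional using (Unique)
open import Data.Product using (Σ; ∃; ∃₂; _×_; _,_)
open import Data.Sum using (_⊎_; inj₁; inj₂)
open import Data.Unit using (⊤)
open import Data.Empty using (⊥)
open import Data.Bool using (Bool; true; false; not)
open import Data.Refinement using (Refinement; value)
open import Function.Bundles using (_↔_; _⇔_)
open import Relation.Nullary using (¬_)
open import Relation.Binary.PropositionalEquality using (_≡_; _≢_)

Finite : Set → Set
Finite A = Σ ℕ λ n → A ↔ Fin n

record Graph : Set₁ where
  constructor mkGraph
  field
    V : Set
    E : V → V → Set
open Graph public

module _ (G : Graph) where

  ChainFrom : V G → List (V G) → Set
  ChainFrom a [] = ⊤
  ChainFrom a (b ∷ r) = E G a b × ChainFrom b r

  End : V G → List (V G) → V G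
  End a [] = a
  End a (b ∷ r) = End b r

  Path : V G → V G → List (V G) → Set
  Path a b rest = ChainFrom a rest × End a rest ≡ b × Unique (a ∷ rest)

  Reach : V G → V G → Set
  Reach a b = ∃ λ rest → Path a b rest

  Connected : Set
  Connected = ∀ a b → Reach a b

  Degree : V G → ℕ → Set
  Degree v k = Σ (List (V G)) λ ns →
    length ns ≡ k × Unique ns × (∀ w → E G v w ⇔ (w ∈ ns))

  Cycle : V G → List (V G) → Set
  Cycle a rest = 2 ≤ length rest × ChainFrom a rest
               × E G (End a rest) a × Unique (a ∷ rest)

  Acyclic : Set
  Acyclic = ∀ a rest → ¬ Cycle a rest

SameEdge : {A : Set} → A → A → A → A → Set
SameEdge a b c d = (a ≡ c × b ≡ d) ⊎ (a ≡ d × b ≡ c)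

DeleteEdge : (G : Graph) → V G → V G → Graph
DeleteEdge G a b = mkGraph (V G) (λ x y → E G x y × ¬ SameEdge x y a b)

CutEdge : (G : Graph) → V G → V G → Set
CutEdge G a b = E G a b × ¬ Connected (DeleteEdge G a b)

IncidentToCutEdge : (G : Graph) → V G → Set
IncidentToCutEdge G v = ∃ λ w → CutEdge G v w

-- every cycle contains three cyclically consecutive vertices,
-- each incident to a cut-edge
ThreeCuttableGraph : Graph → Set
ThreeCuttableGraph G = ∀ a rest → Cycle G a rest →
  Σ (List (V G)) λ pre → Σ (List (V G)) λ suf → Σ (V G) λ p → Σ (V G) λ q → Σ (V G) λ r →
    ((a ∷ rest) ++ (a ∷ take 1 rest) ≡ pre ++ p ∷ q ∷ r ∷ suf)
    × IncidentToCutEdge G p × IncidentToCutEdge G q × IncidentToCutEdge G r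

record Network (X : Set) : Set₁ where
  field
    graph     : Graph
    lab       : X → V graph
    finite    : Finite (V graph)
    sym       : ∀ a b → E graph a b → E graph b a
    irrefl    : ∀ a → ¬ E graph a a
    connected : Connected graph
    degree    : ∀ v → Degree graph v 1 ⊎ Degree graph v 3
    lab-leaf  : ∀ x → Degree graph (lab x) 1
    leaf-lab  : ∀ v → Degree graph v 1 → ∃ λ x → lab x ≡ v
    lab-inj   : ∀ x y → lab x ≡ lab y → x ≡ y
open Network public

Vert : {X : Set} → Network X → Set
Vert N = V (graph N)

Leaf : {X : Set} (N : Network X) → Vert N → Set
Leaf N v = Degree (graph N) v 1

IsTree : {X : Set} → Network X → Set
IsTree N = Acyclic (graph N)

IsSimple : {X : Set} → Network X → Set
IsSimple N = ∀ a b → CutEdge (graph N) a b → Leaf N a ⊎ Leaf N b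

ThreeCuttable : {X : Set} → Network X → Set
ThreeCuttable N = ThreeCuttableGraph (graph N)

NonTrivialCutEdge : {X : Set} (N : Network X) → Vert N → Vert N → Set
NonTrivialCutEdge N a b = CutEdge (graph N) a b × ¬ Leaf N a × ¬ Leaf N b

UsesEdge : {A : Set} → A → List A → A → A → Set
UsesEdge a rest c d = ∃₂ λ pre suf →
  (a ∷ rest ≡ pre ++ c ∷ d ∷ suf) ⊎ (a ∷ rest ≡ pre ++ d ∷ c ∷ suf)

-- edge {a,b} induces the split X₁|X₂ with X₁ = {x | P x ≡ true},
-- X₂ = {x | P x ≡ false}, and a lies on the side containing X₁
InducesSplit : {X : Set} (N : Network X) → Vert N → Vert N → (X → Bool) → Set
InducesSplit N a b P =
  E (graph N) a b
  × (∃ λ x → P x ≡ true) × (∃ λ x → P x ≡ false)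
  × (∀ x y → P x ≡ true → P y ≡ false → ∀ rest →
       Path (graph N) (lab N x) (lab N y) rest → UsesEdge (lab N x) rest a b)

OnSideOf : {X : Set} (N : Network X) → Vert N → Vert N → (X → Bool) → Set
OnSideOf N a b P = ∀ x → P x ≡ true → Reach (DeleteEdge (graph N) a b) a (lab N x)

record LGraph (L : Set) : Set₁ where
  constructor mkLGraph
  field
    base : Graph
    Lab  : L → V base → Set
open LGraph public

Labelled : {X : Set} → Network X → LGraph X
Labelled N = mkLGraph (graph N) (λ x v → lab N x ≡ v)

-- Side N a b Q : the component of N - {a,b} containing a, together with
-- a new leaf (the unique element of ⊤) joined to a; its labels are
-- {x ∈ X | Q x ≡ true} ∪ {new leaf}.
module _ {X : Set} (N : Network X) (a b : Vert N) (Q : X → Bool) where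
  private
    G- : Graph
    G- = DeleteEdge (graph N) a b
    C : Set
    C = Refinement (Vert N) (Reach G- a)

  SideE : C ⊎ ⊤ → C ⊎ ⊤ → Set
  SideE (inj₁ p) (inj₁ q) = E G- (value p) (value q)
  SideE (inj₁ p) (inj₂ _) = value p ≡ a
  SideE (inj₂ _) (inj₁ q) = value q ≡ a
  SideE (inj₂ _) (inj₂ _) = ⊥

  SideLab : (Σ X (λ x → Q x ≡ true)) ⊎ ⊤ → C ⊎ ⊤ → Set
  SideLab (inj₁ (x , _)) (inj₁ p) = lab N x ≡ value p
  SideLab (inj₁ _) (inj₂ _) = ⊥
  SideLab (inj₂ _) (inj₁ _) = ⊥
  SideLab (inj₂ _) (inj₂ _) = ⊤

  Side : LGraph ((Σ X (λ x → Q x ≡ true)) ⊎ ⊤)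
  Side = mkLGraph (mkGraph (C ⊎ ⊤) SideE) SideLab

-- Displays H G : some subgraph of H is a (label-preserving) subdivision
-- of G: branch vertices φ, and for every edge {a,b} of G a path in H
-- from φ a to φ b (interior π a b e), interiors avoiding branch vertices
-- and pairwise disjoint for distinct edges.
Displays : {L : Set} → LGraph L → LGraph L → Set
Displays H G =
  Σ (V (base G) → V (base H)) λ φ →
    (∀ a b → φ a ≡ φ b → a ≡ b)
  × (∀ l a → Lab G l a → Lab H l (φ a))
  × Σ (∀ a b → E (base G) a b → List (V (base H))) λ π →
      (∀ a b e → Path (base H) (φ a) (φ b) (π a b e ++ φ b ∷ []))
    × (∀ a b e w → w ∈ π a b e → ∀ c → φ c ≢ w)
    × (∀ a b e c d e′ w → ¬ SameEdge a b c d → w ∈ π a b e → w ∈ π c d e′ → ⊥)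

-- Since e = {u,v} and e′ = {u′,v′} induce the same split, an embedding of T in U routes the image
-- of e′ through e and the image of no other edge of T: if the image path of an edge {a,b} ≠ e′
-- used e, take leaves x beyond u′ and y beyond v′ whose tree paths to e′ avoid {a,b} (they exist
-- as T is a finite tree); the image of the tree path from x to y through e′ avoids e, because
-- image paths of distinct edges share at most one vertex, so x and y would be joined in U − e.
-- Hence the embedding restricts to each side of U − e, the image of e′ being cut where it first
-- uses e. Conversely, embeddings of the two sides glue: in U₁ the image of {u′,x₁} reaches x₁
-- from u, in U₂ the image of {x₂,v′} leaves x₂ to v, and joined through e they form the image
-- of e′. The two sides of U − e are disjoint, which keeps all glued paths internally disjoint.

module Submission where

open import Defs hiding (sym)
open import Data.Bool using (Bool; true; false; not)
open import Data.Nat using (ℕ; zero; suc; _+_; _≤_; _<_; z≤n; s≤s)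
open import Data.Nat.Properties using (+-suc; m<m+n)
open import Data.Empty using (⊥; ⊥-elim)
import Data.Empty.Irrelevant as Irrelevant
open import Data.Fin using (Fin; zero; suc) renaming (_<_ to _<ᶠ_)
import Data.Fin.Properties as Fin
open import Data.List using (List; []; _∷_; _++_; length; lookup; map; reverse)
open import Data.List.Properties
  using (∷-injective; ++-assoc; length-++-sucʳ; map-++; unfold-reverse; reverse-++)
open import Data.List.Membership.Propositional using (_∈_; _∉_)
open import Data.List.Membership.Propositional.Properties
  using (∈-++⁻; ∈-++⁺ˡ; ∈-++⁺ʳ; ∈-map⁺; ∈-map⁻; ∈-∃++; ∈-lookup)
open import Data.List.Relation.Unary.Any using (here; there; any?)
import Data.List.Relation.Unary.Any.Properties as Any
open import Data.List.Relation.Unary.All as All using (All; []; _∷_)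
import Data.List.Relation.Unary.All.Properties as All
open import Data.List.Relation.Unary.AllPairs using ([]; _∷_)
open import Data.List.Relation.Unary.Unique.Propositional using (Unique)
import Data.List.Relation.Unary.Unique.Propositional.Properties as Unique
open import Data.List.Relation.Binary.Disjoint.Propositional using (Disjoint)
open import Data.Irrelevant using ([_])
open import Data.Product using (Σ; ∃; ∃₂; _×_; _,_; proj₁; proj₂)
open import Data.Refinement using (_,_; value; value-injective)
open import Data.Sum as Sum using (_⊎_; inj₁; inj₂)
open import Data.Unit using (tt)
open import Function.Base using (_∘_)
open import Function.Bundles using (_⇔_; mk⇔; _↣_; Injection; Equivalence)
open import Function.Properties.Inverse using (↔⇒↣)
open import Relation.Binary.Construct.Closure.ReflexiveTransitive as Star
  using (Star; ε; _◅_; _◅◅_)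
open import Relation.Binary.Definitions using (DecidableEquality)
open import Relation.Binary.PropositionalEquality
  using (_≡_; _≢_; refl; sym; trans; cong; subst; subst₂; module ≡-Reasoning)
open import Relation.Nullary using (¬_; Dec; yes; no)

module _ {A : Set} where

  Unique-++⁻ˡ : ∀ (xs : List A) {ys} → Unique (xs ++ ys) → Unique xs
  Unique-++⁻ˡ []       _        = []
  Unique-++⁻ˡ (x ∷ xs) (x∉ ∷ u) = All.++⁻ˡ xs x∉ ∷ Unique-++⁻ˡ xs u

  Unique-++⁻ʳ : ∀ (xs : List A) {ys} → Unique (xs ++ ys) → Unique ys
  Unique-++⁻ʳ []       u       = u
  Unique-++⁻ʳ (x ∷ xs) (_ ∷ u) = Unique-++⁻ʳ xs u

  Unique-++⇒Disjoint : ∀ (xs : List A) {ys} → Unique (xs ++ ys) → Disjoint xs ys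
  Unique-++⇒Disjoint (x ∷ xs) (x∉ ∷ u) (here refl , y∈) = All.lookup (All.++⁻ʳ xs x∉) y∈ refl
  Unique-++⇒Disjoint (x ∷ xs) (_  ∷ u) (there y∈ , y∈′) = Unique-++⇒Disjoint xs u (y∈ , y∈′)

  Unique-∷ : ∀ {x : A} {xs} → x ∉ xs → Unique xs → Unique (x ∷ xs)
  Unique-∷ x∉ u = All.tabulate (λ { y∈ refl → x∉ y∈ }) ∷ u

  Unique-lookup : ∀ (xs : List A) {i j : Fin (length xs)} → i <ᶠ j → Unique xs →
                  lookup xs i ≢ lookup xs j
  Unique-lookup (x ∷ xs) {zero}  {suc j} _         (x∉ ∷ _) = All.lookup x∉ (∈-lookup j)
  Unique-lookup (x ∷ xs) {suc i} {suc j} (s≤s i<j) (_ ∷ u)  = Unique-lookup xs i<j u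

  Unique-length : ∀ {n} → A ↣ Fin n → ∀ {xs} → Unique xs → ¬ n < length xs
  Unique-length A↣Fin {xs} u n<len
    with i , j , i<j , eq ← Fin.pigeonhole n<len (Injection.to A↣Fin ∘ lookup xs) =
    Unique-lookup xs i<j u (Injection.injective A↣Fin eq)

  Unique-reverse : ∀ {xs : List A} → Unique xs → Unique (reverse xs)
  Unique-reverse {[]}     _        = []
  Unique-reverse {x ∷ xs} (x∉ ∷ u) rewrite unfold-reverse x xs =
    Unique.++⁺ (Unique-reverse u) ([] ∷ [])
      λ { (x∈ , here refl) → All.lookup x∉ (Any.reverse⁻ x∈) refl }

module _ {A : Set} where

  SameEdge-refl : ∀ {a b : A} → SameEdge a b a b
  SameEdge-refl = inj₁ (refl , refl)

  SameEdge-swapˡ : ∀ {a b c d : A} → SameEdge a b c d → SameEdge b a c d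
  SameEdge-swapˡ (inj₁ (p , q)) = inj₂ (q , p)
  SameEdge-swapˡ (inj₂ (p , q)) = inj₁ (q , p)

  SameEdge-swapʳ : ∀ {a b c d : A} → SameEdge a b c d → SameEdge a b d c
  SameEdge-swapʳ (inj₁ (p , q)) = inj₂ (p , q)
  SameEdge-swapʳ (inj₂ (p , q)) = inj₁ (p , q)

  SameEdge-sym : ∀ {a b c d : A} → SameEdge a b c d → SameEdge c d a b
  SameEdge-sym (inj₁ (refl , refl)) = inj₁ (refl , refl)
  SameEdge-sym (inj₂ (refl , refl)) = inj₂ (refl , refl)

  SameEdge-trans : ∀ {a b c d e f : A} → SameEdge a b c d → SameEdge c d e f → SameEdge a b e f
  SameEdge-trans (inj₁ (refl , refl)) s = s
  SameEdge-trans (inj₂ (refl , refl)) s = SameEdge-swapˡ s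

  SameEdge-dec : DecidableEquality A → ∀ (a b c d : A) → Dec (SameEdge a b c d)
  SameEdge-dec _≟_ a b c d with a ≟ c | b ≟ d | a ≟ d | b ≟ c
  ... | yes p | yes q | _     | _     = yes (inj₁ (p , q))
  ... | _     | _     | yes p | yes q = yes (inj₂ (p , q))
  ... | no p  | _     | no r  | _     = no λ { (inj₁ (x , _)) → p x ; (inj₂ (x , _)) → r x }
  ... | no p  | _     | yes _ | no s  = no λ { (inj₁ (x , _)) → p x ; (inj₂ (_ , y)) → s y }
  ... | yes _ | no q  | no r  | _     = no λ { (inj₁ (_ , y)) → q y ; (inj₂ (x , _)) → r x }
  ... | yes _ | no q  | yes _ | no s  = no λ { (inj₁ (_ , y)) → q y ; (inj₂ (_ , y)) → s y }

  SameEdge-endpoints : ∀ {x y a b : A} → x ≢ y → (x ≡ a ⊎ x ≡ b) → (y ≡ a ⊎ y ≡ b) → SameEdge x y a b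
  SameEdge-endpoints x≢y (inj₁ refl) (inj₁ refl) = ⊥-elim (x≢y refl)
  SameEdge-endpoints x≢y (inj₁ refl) (inj₂ refl) = inj₁ (refl , refl)
  SameEdge-endpoints x≢y (inj₂ refl) (inj₁ refl) = inj₂ (refl , refl)
  SameEdge-endpoints x≢y (inj₂ refl) (inj₂ refl) = ⊥-elim (x≢y refl)

SameEdge-map : ∀ {A B : Set} (f : A → B) {a b c d} → SameEdge a b c d → SameEdge (f a) (f b) (f c) (f d)
SameEdge-map f (inj₁ (refl , refl)) = inj₁ (refl , refl)
SameEdge-map f (inj₂ (refl , refl)) = inj₂ (refl , refl)

SameEdge-map⁻ : ∀ {A B : Set} {f : A → B} → (∀ {x y} → f x ≡ f y → x ≡ y) →
                ∀ {a b c d} → SameEdge (f a) (f b) (f c) (f d) → SameEdge a b c d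
SameEdge-map⁻ inj (inj₁ (p , q)) = inj₁ (inj p , inj q)
SameEdge-map⁻ inj (inj₂ (p , q)) = inj₂ (inj p , inj q)

module _ {G : Graph} where

  End-++ : ∀ a xs ys → End G a (xs ++ ys) ≡ End G (End G a xs) ys
  End-++ a []       ys = refl
  End-++ a (x ∷ xs) ys = End-++ x xs ys

  End-∷ʳ : ∀ a xs b → End G a (xs ++ b ∷ []) ≡ b
  End-∷ʳ a xs b = End-++ a xs (b ∷ [])

  End-∈ : ∀ a xs → End G a xs ∈ a ∷ xs
  End-∈ a []       = here refl
  End-∈ a (x ∷ xs) = there (End-∈ x xs)

  ChainFrom-++⁻ : ∀ a xs {ys} → ChainFrom G a (xs ++ ys) → ChainFrom G a xs × ChainFrom G (End G a xs) ys
  ChainFrom-++⁻ a []       c       = _ , c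
  ChainFrom-++⁻ a (x ∷ xs) (e , c) = let c₁ , c₂ = ChainFrom-++⁻ x xs c in (e , c₁) , c₂

  ChainFrom-++⁺ : ∀ a xs {ys} → ChainFrom G a xs → ChainFrom G (End G a xs) ys → ChainFrom G a (xs ++ ys)
  ChainFrom-++⁺ a []       _        c₂ = c₂
  ChainFrom-++⁺ a (x ∷ xs) (e , c₁) c₂ = e , ChainFrom-++⁺ x xs c₁ c₂

  ChainFrom-edge : ∀ a xs pre {c d suf} → a ∷ xs ≡ pre ++ c ∷ d ∷ suf → ChainFrom G a xs → E G c d
  ChainFrom-edge a (x ∷ xs) []        refl (e , _) = e
  ChainFrom-edge a []       (_ ∷ [])    ()
  ChainFrom-edge a []       (_ ∷ _ ∷ _) ()
  ChainFrom-edge a (x ∷ xs) (_ ∷ pre) eq   (_ , c) = ChainFrom-edge x xs pre (proj₂ (∷-injective eq)) c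

  ChainFrom-reverse : (∀ {x y} → E G x y → E G y x) →
                      ∀ a xs b → ChainFrom G a (xs ++ b ∷ []) → ChainFrom G b (reverse xs ++ a ∷ [])
  ChainFrom-reverse sym-E a []       b (e , _) = sym-E e , _
  ChainFrom-reverse sym-E a (x ∷ xs) b (e , c)
    rewrite unfold-reverse x xs | ++-assoc (reverse xs) (x ∷ []) (a ∷ [])
    with c₁ , (e₁ , _) ← ChainFrom-++⁻ b (reverse xs) (ChainFrom-reverse sym-E x xs b c)
    = ChainFrom-++⁺ b (reverse xs) c₁ (e₁ , sym-E e , _)

End-map : ∀ {G H : Graph} (f : V G → V H) a xs → f (End G a xs) ≡ End H (f a) (map f xs)
End-map f a []       = refl
End-map f a (x ∷ xs) = End-map f x xs

End-DeleteEdge : ∀ {G : Graph} {u v} a xs → End (DeleteEdge G u v) a xs ≡ End G a xs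
End-DeleteEdge a []       = refl
End-DeleteEdge a (x ∷ xs) = End-DeleteEdge x xs

module _ {G H : Graph} {f : V G → V H} where

  ChainFrom-map : (∀ {x y} → E G x y → E H (f x) (f y)) →
                  ∀ a xs → ChainFrom G a xs → ChainFrom H (f a) (map f xs)
  ChainFrom-map hom a []       _       = _
  ChainFrom-map hom a (x ∷ xs) (e , c) = hom e , ChainFrom-map hom x xs c

  ChainFrom-map⁻ : {P : V G → Set} → (∀ {x y} → P x → P y → E H (f x) (f y) → E G x y) →
                   ∀ a xs → All P (a ∷ xs) → ChainFrom H (f a) (map f xs) → ChainFrom G a xs
  ChainFrom-map⁻ reflects a []       _                  _       = _
  ChainFrom-map⁻ reflects a (x ∷ xs) (pa ∷ all@(px ∷ _)) (e , c) =
    reflects pa px e , ChainFrom-map⁻ reflects x xs all c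

  module _ (f-inj : ∀ {x y} → f x ≡ f y → x ≡ y) where

    Path-map : (∀ {x y} → E G x y → E H (f x) (f y)) →
               ∀ {a b xs} → Path G a b xs → Path H (f a) (f b) (map f xs)
    Path-map hom {a} {b} {xs} (c , en , u) =
      ChainFrom-map hom a xs c , trans (sym (End-map f a xs)) (cong f en) , Unique.map⁺ f-inj u

    Path-map⁻ : {P : V G → Set} → (∀ {x y} → P x → P y → E H (f x) (f y) → E G x y) →
                ∀ {a b xs} → All P (a ∷ xs) → Path H (f a) (f b) (map f xs) → Path G a b xs
    Path-map⁻ reflects {a} {b} {xs} all (c , en , u) =
      ChainFrom-map⁻ reflects a xs all c , f-inj (trans (End-map f a xs) en) , Unique.map⁻ u

module _ {G : Graph} where

  Path-join : ∀ {a b c xs ys} → Path G a b xs → Path G b c ys → Disjoint (a ∷ xs) ys →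
              Path G a c (xs ++ ys)
  Path-join {a} {xs = xs} {ys} (c₁ , refl , u₁) (c₂ , refl , _ ∷ u₂) disj =
    ChainFrom-++⁺ a xs c₁ c₂ , End-++ a xs ys , Unique.++⁺ u₁ u₂ disj

  Path-∷ʳ : ∀ {a b c xs} → Path G a b xs → E G b c → c ∉ a ∷ xs → Path G a c (xs ++ c ∷ [])
  Path-∷ʳ {a} {c = c} {xs} (ch , refl , u) e c∉ =
    ChainFrom-++⁺ a xs ch (e , _) , End-∷ʳ a xs c ,
    Unique.++⁺ u ([] ∷ []) λ { (c∈ , here refl) → c∉ c∈ }

  Path-init : ∀ {a c xs} → Path G a c (xs ++ c ∷ []) → Path G a (End G a xs) xs
  Path-init {a} {c} {xs} (ch , _ , u) = proj₁ (ChainFrom-++⁻ a xs ch) , refl , Unique-++⁻ˡ (a ∷ xs) u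

  Path-reverse : (∀ {x y} → E G x y → E G y x) →
                 ∀ {a b xs} → Path G a b (xs ++ b ∷ []) → Path G b a (reverse xs ++ a ∷ [])
  Path-reverse sym-E {a} {b} {xs} (c , _ , u) =
    ChainFrom-reverse sym-E a xs b c , End-∷ʳ b (reverse xs) a , subst Unique reversed (Unique-reverse u)
    where
    open ≡-Reasoning
    reversed : reverse (a ∷ xs ++ b ∷ []) ≡ b ∷ reverse xs ++ a ∷ []
    reversed = begin
      reverse (a ∷ xs ++ b ∷ [])         ≡⟨ unfold-reverse a (xs ++ b ∷ []) ⟩
      reverse (xs ++ b ∷ []) ++ a ∷ []   ≡⟨ cong (_++ a ∷ []) (reverse-++ xs (b ∷ [])) ⟩
      b ∷ reverse xs ++ a ∷ []           ∎

  Path-end-∉ : ∀ {a b xs} → Path G a b (xs ++ b ∷ []) → b ∉ a ∷ xs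
  Path-end-∉ {a} {b} {xs} (_ , _ , u) b∈ = Unique-++⇒Disjoint (a ∷ xs) u (b∈ , here refl)

  Path-start-∉ : ∀ {a b xs} → Path G a b xs → a ∉ xs
  Path-start-∉ (_ , _ , a∉ ∷ _) a∈ = All.lookup a∉ a∈ refl

  Path-suffix : ∀ {a c xs} pre b suf → a ∷ xs ≡ pre ++ b ∷ suf → Path G a c xs → Path G b c suf
  Path-suffix []        b suf refl p            = p
  Path-suffix {a} (_ ∷ pre) b suf eq (ch , en , u) with refl , refl ← ∷-injective eq =
    proj₂ (proj₂ (ChainFrom-++⁻ a pre ch)) , trans (sym (End-++ a pre (b ∷ suf))) en ,
    Unique-++⁻ʳ (a ∷ pre) u

Walk : (G : Graph) → V G → V G → Set
Walk G = Star (E G)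

module _ {G : Graph} where

  ChainFrom⇒Walk : ∀ a xs → ChainFrom G a xs → Walk G a (End G a xs)
  ChainFrom⇒Walk a []       _       = ε
  ChainFrom⇒Walk a (x ∷ xs) (e , c) = e ◅ ChainFrom⇒Walk x xs c

  Reach⇒Walk : ∀ {a b} → Reach G a b → Walk G a b
  Reach⇒Walk {a} (xs , c , refl , _) = ChainFrom⇒Walk a xs c

  Walk⇒Reach : DecidableEquality (V G) → ∀ {a b} → Walk G a b → Reach G a b
  Walk⇒Reach _≟_ ε = [] , _ , refl , [] ∷ []
  Walk⇒Reach _≟_ {a} (_◅_ {j = b} e w) with xs , p ← Walk⇒Reach _≟_ w | any? (a ≟_) (b ∷ xs)
  ... | no a∉  = b ∷ xs , (e , proj₁ p) , proj₁ (proj₂ p) , Unique-∷ a∉ (proj₂ (proj₂ p))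
  ... | yes a∈ with pre , suf , eq ← ∈-∃++ a∈ = suf , Path-suffix pre a suf eq p

module _ {G : Graph} {u v : V G} where

  DeleteEdge-sym : (∀ {a b} → E G a b → E G b a) →
                   ∀ {a b} → E (DeleteEdge G u v) a b → E (DeleteEdge G u v) b a
  DeleteEdge-sym sym-E (e , ne) = sym-E e , ne ∘ SameEdge-swapˡ

  DeleteEdge-swap : ∀ {a b} → E (DeleteEdge G u v) a b → E (DeleteEdge G v u) a b
  DeleteEdge-swap (e , ne) = e , ne ∘ SameEdge-swapʳ

  Walk-DeleteEdge-swap : ∀ {a b} → Walk (DeleteEdge G u v) a b → Walk (DeleteEdge G v u) a b
  Walk-DeleteEdge-swap = Star.map DeleteEdge-swap

  ChainFrom-DeleteEdge-swap : ∀ a xs → ChainFrom (DeleteEdge G u v) a xs → ChainFrom (DeleteEdge G v u) a xs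
  ChainFrom-DeleteEdge-swap a []       _       = _
  ChainFrom-DeleteEdge-swap a (x ∷ xs) (e , c) = DeleteEdge-swap e , ChainFrom-DeleteEdge-swap x xs c

  ChainFrom-DeleteEdge⁻ : ∀ a xs → ChainFrom (DeleteEdge G u v) a xs → ChainFrom G a xs
  ChainFrom-DeleteEdge⁻ a []       _            = _
  ChainFrom-DeleteEdge⁻ a (x ∷ xs) ((e , _) , c) = e , ChainFrom-DeleteEdge⁻ x xs c

  Crossing : V G → List (V G) → Set
  Crossing a xs = ∃₂ λ mid q → ∃ λ suf → xs ≡ mid ++ q ∷ suf
                × ChainFrom (DeleteEdge G u v) a mid × SameEdge (End G a mid) q u v

  first-crossing : DecidableEquality (V G) → ∀ a xs → ChainFrom G a xs →
                   ChainFrom (DeleteEdge G u v) a xs ⊎ Crossing a xs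
  first-crossing _≟_ a []       _       = inj₁ _
  first-crossing _≟_ a (x ∷ xs) (e , c) with SameEdge-dec _≟_ a x u v
  ... | yes s = inj₂ ([] , x , xs , refl , _ , s)
  ... | no ne with first-crossing _≟_ x xs c
  ...   | inj₁ c′ = inj₁ ((e , ne) , c′)
  ...   | inj₂ (mid , q , suf , refl , c′ , s) = inj₂ (x ∷ mid , q , suf , refl , ((e , ne) , c′) , s)

  Crossing-endpoints : ∀ {a xs} → Crossing a xs → u ∈ a ∷ xs × v ∈ a ∷ xs
  Crossing-endpoints {a} (mid , q , suf , refl , _ , s) = endpoints s
    where
    end∈ : End G a mid ∈ a ∷ mid ++ q ∷ suf
    end∈ = ∈-++⁺ˡ (End-∈ a mid)
    q∈ : q ∈ a ∷ mid ++ q ∷ suf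
    q∈ = there (∈-++⁺ʳ mid (here refl))
    endpoints : SameEdge (End G a mid) q u v → u ∈ a ∷ mid ++ q ∷ suf × v ∈ a ∷ mid ++ q ∷ suf
    endpoints (inj₁ (refl , refl)) = end∈ , q∈
    endpoints (inj₂ (refl , refl)) = q∈ , end∈

Del : {X : Set} (N : Network X) → Vert N → Vert N → Graph
Del N = DeleteEdge (graph N)

module NetworkFacts {X : Set} (N : Network X) where

  _≟_ : DecidableEquality (Vert N)
  _≟_ = Fin.inj⇒≟ (↔⇒↣ (proj₂ (finite N)))

  E-sym : ∀ {a b} → E (graph N) a b → E (graph N) b a
  E-sym = Network.sym N _ _

  Walk-reverse : ∀ {u v a b} → Walk (Del N u v) a b → Walk (Del N u v) b a
  Walk-reverse = Star.reverse (DeleteEdge-sym E-sym)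

  reached-from-an-end : ∀ u v w → Walk (Del N u v) u w ⊎ Walk (Del N u v) v w
  reached-from-an-end u v w = go (Reach⇒Walk (connected N u w)) (inj₁ ε)
    where
    go : ∀ {a b} → Walk (graph N) a b →
         Walk (Del N u v) u a ⊎ Walk (Del N u v) v a → Walk (Del N u v) u b ⊎ Walk (Del N u v) v b
    go ε s = s
    go {a} (_◅_ {j = b} e w) s with SameEdge-dec _≟_ a b u v
    ... | yes (inj₁ (refl , refl)) = go w (inj₂ ε)
    ... | yes (inj₂ (refl , refl)) = go w (inj₁ ε)
    ... | no ne = go w (Sum.map (_◅◅ (e , ne) ◅ ε) (_◅◅ (e , ne) ◅ ε) s)

  module Split {u v : Vert N} {P : X → Bool} (split : InducesSplit N u v P) (near : OnSideOf N u v P) where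

    no-crossing : ∀ {x y} → P x ≡ true → P y ≡ false → ¬ Walk (Del N u v) (lab N x) (lab N y)
    no-crossing {x} {y} px py w with Walk⇒Reach _≟_ w
    ... | rest , ch , en , un
      with proj₂ (proj₂ (proj₂ split)) x y px py rest
             (ChainFrom-DeleteEdge⁻ _ rest ch , trans (sym (End-DeleteEdge _ rest)) en , un)
    ...   | pre , _ , inj₁ eq = proj₂ (ChainFrom-edge _ rest pre eq ch) SameEdge-refl
    ...   | pre , _ , inj₂ eq = proj₂ (ChainFrom-edge _ rest pre eq ch) (inj₂ (refl , refl))

    x₀ : X
    x₀ = proj₁ (proj₁ (proj₂ split))

    Px₀ : P x₀ ≡ true
    Px₀ = proj₂ (proj₁ (proj₂ split))

    y₀ : X
    y₀ = proj₁ (proj₁ (proj₂ (proj₂ split)))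

    Py₀ : P y₀ ≡ false
    Py₀ = proj₂ (proj₁ (proj₂ (proj₂ split)))

    near-leaf : ∀ {x} → P x ≡ true → Walk (Del N u v) u (lab N x)
    near-leaf {x} px = Reach⇒Walk (near x px)

    far-leaf : ∀ {y} → P y ≡ false → Walk (Del N u v) v (lab N y)
    far-leaf {y} py with reached-from-an-end u v (lab N y)
    ... | inj₂ w = w
    ... | inj₁ w = ⊥-elim (no-crossing Px₀ py (Walk-reverse (near-leaf Px₀) ◅◅ w))

    ends-apart : ∀ {w} → Walk (Del N u v) u w → Walk (Del N u v) v w → ⊥
    ends-apart w₁ w₂ = no-crossing Px₀ Py₀
      (Walk-reverse (near-leaf Px₀) ◅◅ w₁ ◅◅ Walk-reverse w₂ ◅◅ far-leaf Py₀)

    near⇒true : ∀ {x} → Walk (Del N u v) u (lab N x) → P x ≡ true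
    near⇒true {x} w with P x in px
    ... | true  = refl
    ... | false = ⊥-elim (ends-apart w (far-leaf px))

    far⇒false : ∀ {x} → Walk (Del N u v) v (lab N x) → P x ≡ false
    far⇒false {x} w with P x in px
    ... | false = refl
    ... | true  = ⊥-elim (ends-apart (near-leaf px) w)

module _ {X : Set} (T : Network X) (tree : IsTree T) where
  open NetworkFacts T
  private
    GT = graph T

  off-path : ∀ {c p rest w} → ChainFrom GT c (p ∷ rest) → Unique (c ∷ p ∷ rest) →
             E GT c w → w ≢ p → w ∉ c ∷ p ∷ rest
  off-path _ _ cw _ (here refl) = irrefl T _ cw
  off-path _ _ _ w≢p (there (here refl)) = w≢p refl
  off-path {c} {p} {rest} {w} (cp , ch) u cw _ (there (there w∈))
    with pre , post , refl ← ∈-∃++ w∈ = tree c (p ∷ pre ++ w ∷ []) cycle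
    where
    reassoc : pre ++ w ∷ post ≡ (pre ++ w ∷ []) ++ post
    reassoc = sym (++-assoc pre (w ∷ []) post)
    cycle : Cycle GT c (p ∷ pre ++ w ∷ [])
    cycle = s≤s (subst (1 ≤_) (sym (length-++-sucʳ pre w [])) (s≤s z≤n))
          , (cp , proj₁ (ChainFrom-++⁻ p (pre ++ w ∷ []) (subst (ChainFrom GT p) reassoc ch)))
          , subst (λ z → E GT z c) (sym (End-∷ʳ p pre w)) (E-sym cw)
          , Unique-++⁻ˡ (c ∷ p ∷ pre ++ w ∷ []) (subst (λ l → Unique (c ∷ p ∷ l)) reassoc u)

  module _ {f₁ f₂ : Vert T} where

    private
      Blocked : Vert T → Vert T → Vert T → Set
      Blocked c p w = w ≡ p ⊎ SameEdge c w f₁ f₂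

      Blocked? : ∀ c p w → Dec (Blocked c p w)
      Blocked? c p w with w ≟ p | SameEdge-dec _≟_ c w f₁ f₂
      ... | yes eq | _     = yes (inj₁ eq)
      ... | no _   | yes s = yes (inj₂ s)
      ... | no ne  | no ns = no λ { (inj₁ eq) → ne eq ; (inj₂ s) → ns s }

      one-neighbour-per-edge : ∀ {c w₁ w₂} → E GT c w₁ → E GT c w₂ → w₁ ≢ w₂ →
                               SameEdge c w₁ f₁ f₂ → ¬ SameEdge c w₂ f₁ f₂
      one-neighbour-per-edge _  _  ne (inj₁ (refl , refl)) (inj₁ (refl , refl)) = ne refl
      one-neighbour-per-edge _  e₂ _  (inj₁ (refl , refl)) (inj₂ (refl , refl)) = irrefl T _ e₂
      one-neighbour-per-edge e₁ _  _  (inj₂ (refl , refl)) (inj₁ (refl , refl)) = irrefl T _ e₁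
      one-neighbour-per-edge _  _  ne (inj₂ (refl , refl)) (inj₂ (refl , refl)) = ne refl

      two-blocked-at-most : ∀ {c p n₁ n₂ n₃} → E GT c n₁ → E GT c n₂ → E GT c n₃ →
                            n₁ ≢ n₂ → n₁ ≢ n₃ → n₂ ≢ n₃ →
                            Blocked c p n₁ → Blocked c p n₂ → ¬ Blocked c p n₃
      two-blocked-at-most _  _  _  n₁₂ _   _   (inj₁ refl) (inj₁ eq)   _         = n₁₂ (sym eq)
      two-blocked-at-most _  _  _  _   n₁₃ _   (inj₁ refl) (inj₂ _)    (inj₁ eq) = n₁₃ (sym eq)
      two-blocked-at-most _  _  _  _   _   n₂₃ (inj₂ _)    (inj₁ refl) (inj₁ eq) = n₂₃ (sym eq)
      two-blocked-at-most _  e₂ e₃ _   _   n₂₃ (inj₁ refl) (inj₂ s₂)   (inj₂ s₃) =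
        one-neighbour-per-edge e₂ e₃ n₂₃ s₂ s₃
      two-blocked-at-most e₁ _  e₃ _   n₁₃ _   (inj₂ s₁)   (inj₁ refl) (inj₂ s₃) =
        one-neighbour-per-edge e₁ e₃ n₁₃ s₁ s₃
      two-blocked-at-most e₁ e₂ _  n₁₂ _   _   (inj₂ s₁)   (inj₂ s₂)   _         =
        one-neighbour-per-edge e₁ e₂ n₁₂ s₁ s₂

    Fresh : Vert T → Vert T → Vert T → Set
    Fresh c p w = E GT c w × w ≢ p × ¬ SameEdge c w f₁ f₂

    fresh-neighbour : ∀ {c} → Degree GT c 3 → ∀ p → ∃ (Fresh c p)
    fresh-neighbour {c} (n₁ ∷ n₂ ∷ n₃ ∷ [] , refl , (n₁₂ ∷ n₁₃ ∷ []) ∷ (n₂₃ ∷ []) ∷ [] ∷ [] , nbr) p =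
      pick (neighbour (here refl)) (neighbour (there (here refl))) (neighbour (there (there (here refl))))
      where
      neighbour : ∀ {w} → w ∈ n₁ ∷ n₂ ∷ n₃ ∷ [] → E GT c w
      neighbour {w} = Equivalence.from (nbr w)
      pick : E GT c n₁ → E GT c n₂ → E GT c n₃ → ∃ (Fresh c p)
      pick e₁ e₂ e₃ with Blocked? c p n₁ | Blocked? c p n₂ | Blocked? c p n₃
      ... | no b₁  | _      | _      = n₁ , e₁ , b₁ ∘ inj₁ , b₁ ∘ inj₂
      ... | yes _  | no b₂  | _      = n₂ , e₂ , b₂ ∘ inj₁ , b₂ ∘ inj₂
      ... | yes _  | yes _  | no b₃  = n₃ , e₃ , b₃ ∘ inj₁ , b₃ ∘ inj₂
      ... | yes b₁ | yes b₂ | yes b₃ = ⊥-elim (two-blocked-at-most e₁ e₂ e₃ n₁₂ n₁₃ n₂₃ b₁ b₂ b₃)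

    -- Walk away from t through fresh neighbours, which never revisit a vertex since T is a tree;
    -- the fuel k bounds the walk by the number of vertices, so it stops at a leaf.
    leaf-beyond : ∀ {s t} → E GT s t → Σ X λ x → Walk (DeleteEdge (Del T s t) f₁ f₂) (lab T x) s
    leaf-beyond {s} {t} st =
      extend nT s t [] (m<m+n nT (s≤s z≤n)) (st , _) refl ((s≢t ∷ []) ∷ [] ∷ []) (here refl) ε
      where
      nT = proj₁ (finite T)
      G′ = DeleteEdge (Del T s t) f₁ f₂
      s≢t : s ≢ t
      s≢t refl = irrefl T s st
      extend : (k : ℕ) → ∀ c p rest → nT < k + length (c ∷ p ∷ rest) →
               ChainFrom GT c (p ∷ rest) → End GT c (p ∷ rest) ≡ t → Unique (c ∷ p ∷ rest) →
               s ∈ c ∷ p ∷ rest → Walk G′ c s → Σ X λ x → Walk G′ (lab T x) s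
      extend zero c p rest n< _ _ u _ _ = ⊥-elim (Unique-length (↔⇒↣ (proj₂ (finite T))) u n<)
      extend (suc k) c p rest n< ch en u s∈ w with degree T c
      ... | inj₁ leaf with x , refl ← leaf-lab T c leaf = x , w
      ... | inj₂ deg3 with fresh-neighbour deg3 p
      ... | q , cq , q≢p , cq≢f =
        extend k q c (p ∷ rest) (subst (nT <_) (sym (+-suc k _)) n<) (E-sym cq , ch) en (Unique-∷ q∉ u)
               (there s∈) (qc ◅ w)
        where
        q∉ : q ∉ c ∷ p ∷ rest
        q∉ = off-path ch u cq q≢p
        t∈ : t ∈ c ∷ p ∷ rest
        t∈ = subst (_∈ c ∷ p ∷ rest) en (End-∈ c (p ∷ rest))
        qc : E G′ q c
        qc = (E-sym cq , λ { (inj₁ (refl , _)) → q∉ s∈ ; (inj₂ (refl , _)) → q∉ t∈ })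
           , cq≢f ∘ SameEdge-swapˡ

module Display {L : Set} {H G : LGraph L} (D : Displays H G) where

  φ : V (base G) → V (base H)
  φ = proj₁ D

  φ-injective : ∀ {a b} → φ a ≡ φ b → a ≡ b
  φ-injective = proj₁ (proj₂ D) _ _

  φ-label : ∀ {l a} → Lab G l a → Lab H l (φ a)
  φ-label = proj₁ (proj₂ (proj₂ D)) _ _

  π : ∀ a b → E (base G) a b → List (V (base H))
  π = proj₁ (proj₂ (proj₂ (proj₂ D)))

  π-path : ∀ a b e → Path (base H) (φ a) (φ b) (π a b e ++ φ b ∷ [])
  π-path = proj₁ (proj₂ (proj₂ (proj₂ (proj₂ D))))

  π-avoids-φ : ∀ {a b e w} → w ∈ π a b e → ∀ c → φ c ≢ w
  π-avoids-φ = proj₁ (proj₂ (proj₂ (proj₂ (proj₂ (proj₂ D))))) _ _ _ _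

  π-disjoint : ∀ {a b e c d e′ w} → ¬ SameEdge a b c d → w ∈ π a b e → w ∈ π c d e′ → ⊥
  π-disjoint = proj₂ (proj₂ (proj₂ (proj₂ (proj₂ (proj₂ D))))) _ _ _ _ _ _ _

  π-vertices : ∀ a b → E (base G) a b → List (V (base H))
  π-vertices a b e = φ a ∷ π a b e ++ φ b ∷ []

  shared-vertex-is-branch : ∀ {a₁ b₁ e₁ a₂ b₂ e₂ z} → ¬ SameEdge a₁ b₁ a₂ b₂ →
                            z ∈ π-vertices a₁ b₁ e₁ → z ∈ π-vertices a₂ b₂ e₂ → z ≡ φ a₁ ⊎ z ≡ φ b₁
  shared-vertex-is-branch _ (here refl) _ = inj₁ refl
  shared-vertex-is-branch {a₁} {b₁} {e₁} {a₂} {b₂} {e₂} ne (there z∈₁) z∈₂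
    with ∈-++⁻ (π a₁ b₁ e₁) z∈₁
  ... | inj₂ (here refl) = inj₂ refl
  ... | inj₁ z∈π₁ with z∈₂
  ...   | here refl = ⊥-elim (π-avoids-φ z∈π₁ a₂ refl)
  ...   | there z∈₂′ with ∈-++⁻ (π a₂ b₂ e₂) z∈₂′
  ...     | inj₁ z∈π₂        = ⊥-elim (π-disjoint ne z∈π₁ z∈π₂)
  ...     | inj₂ (here refl) = ⊥-elim (π-avoids-φ z∈π₁ b₂ refl)

  at-most-one-shared-vertex : ∀ {a₁ b₁ e₁ a₂ b₂ e₂ p q} → ¬ SameEdge a₁ b₁ a₂ b₂ → p ≢ q →
                              p ∈ π-vertices a₁ b₁ e₁ → q ∈ π-vertices a₁ b₁ e₁ →
                              p ∈ π-vertices a₂ b₂ e₂ → q ∈ π-vertices a₂ b₂ e₂ → ⊥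
  at-most-one-shared-vertex ne p≢q p₁ q₁ p₂ q₂ =
    ne (SameEdge-map⁻ φ-injective (SameEdge-trans (SameEdge-sym edge₁) edge₂))
    where
    ne′ = ne ∘ SameEdge-sym
    edge₁ = SameEdge-endpoints p≢q (shared-vertex-is-branch ne p₁ p₂)  (shared-vertex-is-branch ne q₁ q₂)
    edge₂ = SameEdge-endpoints p≢q (shared-vertex-is-branch ne′ p₂ p₁) (shared-vertex-is-branch ne′ q₂ q₁)

  ImageAvoids : V (base H) → V (base H) → ∀ {c d} → E (base G) c d → Set
  ImageAvoids u v {c} {d} e = ChainFrom (DeleteEdge (base H) u v) (φ c) (π c d e ++ φ d ∷ [])

  ImageAvoids⇒Path : ∀ {u v c d} (e : E (base G) c d) → ImageAvoids u v e →
                     Path (DeleteEdge (base H) u v) (φ c) (φ d) (π c d e ++ φ d ∷ [])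
  ImageAvoids⇒Path {c = c} {d} e avoids =
    avoids , trans (End-DeleteEdge (φ c) (π c d e ++ φ d ∷ [])) (proj₁ (proj₂ (π-path c d e))) ,
    proj₂ (proj₂ (π-path c d e))

  Walk-image : ∀ {a b u v} → (∀ {c d} (e : E (base G) c d) → ¬ SameEdge c d a b → ImageAvoids u v e) →
               ∀ {c d} → Walk (DeleteEdge (base G) a b) c d → Walk (DeleteEdge (base H) u v) (φ c) (φ d)
  Walk-image avoids ε              = ε
  Walk-image avoids ((e , ne) ◅ w) =
    Reach⇒Walk (_ , ImageAvoids⇒Path e (avoids e ne)) ◅◅ Walk-image avoids w

module SideGraph {X : Set} (N : Network X) (a b : Vert N) (Q : X → Bool) where
  open NetworkFacts N

  S : Graph
  S = base (Side N a b Q)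

  new-leaf : V S
  new-leaf = inj₂ tt

  ι : V S → Vert N
  ι (inj₁ c) = value c
  ι (inj₂ _) = b

  ⟨_⟩ : ∀ {w} → .(Walk (Del N a b) a w) → V S
  ⟨ r ⟩ = inj₁ (_ , [ Walk⇒Reach _≟_ r ])

  ι-injective : ¬ Walk (Del N a b) a b → ∀ {s t} → ι s ≡ ι t → s ≡ t
  ι-injective apart {inj₁ _}           {inj₁ _}           eq   = cong inj₁ (value-injective eq)
  ι-injective apart {inj₂ _}           {inj₂ _}           _    = refl
  ι-injective apart {inj₁ (_ , [ r ])} {inj₂ _}           refl = Irrelevant.⊥-elim (apart (Reach⇒Walk r))
  ι-injective apart {inj₂ _}           {inj₁ (_ , [ r ])} refl = Irrelevant.⊥-elim (apart (Reach⇒Walk r))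

  ι-edge : E (graph N) a b → ∀ {s t} → E S s t → E (graph N) (ι s) (ι t)
  ι-edge ab {inj₁ _}       {inj₁ _}       (e , _) = e
  ι-edge ab {inj₁ (_ , _)} {inj₂ _}       refl    = ab
  ι-edge ab {inj₂ _}       {inj₁ (_ , _)} refl    = E-sym ab

  ι-reflects : ∀ {s t} → s ≢ new-leaf → t ≢ new-leaf → E (Del N a b) (ι s) (ι t) → E S s t
  ι-reflects {inj₁ _} {inj₁ _} _  _  e = e
  ι-reflects {inj₂ _}          s≢ _  _ = ⊥-elim (s≢ refl)
  ι-reflects {inj₁ _} {inj₂ _} _  t≢ _ = ⊥-elim (t≢ refl)

  -- Only doubly negated: the reachability proof carried by a vertex of the side is irrelevant.
  ι-near : ∀ s → s ≢ new-leaf → ¬ ¬ Walk (Del N a b) a (ι s)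
  ι-near (inj₁ (_ , [ r ])) _ ¬w = Irrelevant.⊥-elim (¬w (Reach⇒Walk r))
  ι-near (inj₂ _)          s≢ _  = s≢ refl

  ι-label : ∀ {x qx s} → SideLab N a b Q (inj₁ (x , qx)) s → lab N x ≡ ι s
  ι-label {s = inj₁ _} eq = eq

  into-new-leaf : ∀ {s} → E S s new-leaf → ι s ≡ a
  into-new-leaf {inj₁ _} eq = eq

  ChainFrom-near : ∀ {c} → Walk (Del N a b) a c → ∀ xs → ChainFrom (Del N a b) c xs →
                   All (Walk (Del N a b) a) xs
  ChainFrom-near w []       _       = []
  ChainFrom-near w (x ∷ xs) (e , c) = (w ◅◅ e ◅ ε) ∷ ChainFrom-near (w ◅◅ e ◅ ε) xs c

  lift : ∀ xs → .(All (Walk (Del N a b) a) xs) → List (V S)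
  lift []       _  = []
  lift (x ∷ xs) rs = ⟨ All.head rs ⟩ ∷ lift xs (All.tail rs)

  map-ι-lift : ∀ xs .rs → map ι (lift xs rs) ≡ xs
  map-ι-lift []       _  = refl
  map-ι-lift (x ∷ xs) rs = cong (x ∷_) (map-ι-lift xs (All.tail rs))

  lift-old : ∀ xs .rs → All (_≢ new-leaf) (lift xs rs)
  lift-old []       _  = []
  lift-old (x ∷ xs) rs = (λ ()) ∷ lift-old xs (All.tail rs)

  S-sym : ∀ {s t} → E S s t → E S t s
  S-sym {inj₁ _} {inj₁ _} e  = DeleteEdge-sym E-sym e
  S-sym {inj₁ _} {inj₂ _} eq = eq
  S-sym {inj₂ _} {inj₁ _} eq = eq

  module _ (apart : ¬ Walk (Del N a b) a b) where

    Path-ι : E (graph N) a b → ∀ {s t xs} → Path S s t xs → Path (graph N) (ι s) (ι t) (map ι xs)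
    Path-ι ab = Path-map (ι-injective apart) (ι-edge ab)

    Path-ι⁻ : ∀ {s t xs} → All (_≢ new-leaf) (s ∷ xs) → Path (Del N a b) (ι s) (ι t) (map ι xs) →
              Path S s t xs
    Path-ι⁻ = Path-map⁻ (ι-injective apart) ι-reflects

module _ {X : Set} {T U : Network X} (tree : IsTree T) (D : Displays (Labelled U) (Labelled T))
         {u v : Vert U} {u′ v′ : Vert T} {P : X → Bool}
         (splitU : InducesSplit U u v P) (nearU : OnSideOf U u v P)
         (splitT : InducesSplit T u′ v′ P) (nearT : OnSideOf T u′ v′ P) where
  open Display {H = Labelled U} {G = Labelled T} D
  private
    module U = NetworkFacts U
    module T = NetworkFacts T
    module SU = U.Split splitU nearU
    module ST = T.Split splitT nearT

    φ-lab : ∀ x → lab U x ≡ φ (lab T x)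
    φ-lab x = φ-label refl

  image-avoids-cut-edge : ∀ {a b} (e : E (graph T) a b) → ¬ SameEdge a b u′ v′ → ImageAvoids u v e
  image-avoids-cut-edge {a} {b} e ab≢e′ with first-crossing U._≟_ (φ a) _ (proj₁ (π-path a b e))
  ... | inj₁ avoids   = avoids
  ... | inj₂ crossing =
    ⊥-elim (SU.no-crossing Px Py (subst₂ (Walk _) (sym (φ-lab x)) (sym (φ-lab y)) image))
    where
    u≢v : u ≢ v
    u≢v refl = irrefl U u (proj₁ splitU)

    others-avoid : ∀ {c d} (e′ : E (graph T) c d) → ¬ SameEdge c d a b → ImageAvoids u v e′
    others-avoid {c} e′ cd≢ab with first-crossing U._≟_ (φ c) _ (proj₁ (π-path c _ e′))
    ... | inj₁ avoids    = avoids
    ... | inj₂ crossing′ =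
      let u∈′ , v∈′ = Crossing-endpoints crossing′
          u∈  , v∈  = Crossing-endpoints crossing
      in ⊥-elim (at-most-one-shared-vertex cd≢ab u≢v u∈′ v∈′ u∈ v∈)

    drop-cut : ∀ {s t c d} → E (DeleteEdge (Del T s t) a b) c d → E (Del T a b) c d
    drop-cut ((cd , _) , cd≢ab) = cd , cd≢ab

    keep-cut : ∀ {s t c d} → E (DeleteEdge (Del T s t) a b) c d → E (Del T s t) c d
    keep-cut = proj₁

    leaf-by-u′ = leaf-beyond T tree {f₁ = a} {f₂ = b} (proj₁ splitT)
    leaf-by-v′ = leaf-beyond T tree {f₁ = a} {f₂ = b} (T.E-sym (proj₁ splitT))
    x = proj₁ leaf-by-u′
    y = proj₁ leaf-by-v′
    x→u′ = proj₂ leaf-by-u′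
    y→v′ = proj₂ leaf-by-v′

    Px : P x ≡ true
    Px = ST.near⇒true (T.Walk-reverse (Star.map keep-cut x→u′))

    Py : P y ≡ false
    Py = ST.far⇒false (T.Walk-reverse (Walk-DeleteEdge-swap (Star.map keep-cut y→v′)))

    image : Walk (Del U u v) (φ (lab T x)) (φ (lab T y))
    image = Walk-image others-avoid
      (Star.map drop-cut x→u′ ◅◅ (proj₁ splitT , ab≢e′ ∘ SameEdge-sym) ◅
       T.Walk-reverse (Star.map drop-cut y→v′))

module Restriction {X : Set} {T U : Network X} (D : Displays (Labelled U) (Labelled T)) where
  open Display {H = Labelled U} {G = Labelled T} D

  module _ {u v : Vert U} {u′ v′ : Vert T} (Q : X → Bool) (u′v′ : E (graph T) u′ v′)
    (avoids : ∀ {a b} (e : E (graph T) a b) → ¬ SameEdge a b u′ v′ → ImageAvoids u v e)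
    (near : ∀ {w} → Walk (Del T u′ v′) u′ w → Walk (Del U u v) u (φ w))
    (far : ¬ Walk (Del U u v) u (φ v′))
    (apartU : ¬ Walk (Del U u v) u v)
    (apartT : ¬ Walk (Del T u′ v′) u′ v′) where
    private
      module U = NetworkFacts U
      module SU = SideGraph U u v Q
      module ST = SideGraph T u′ v′ Q

    φ₁ : V ST.S → V SU.S
    φ₁ (inj₁ (w , [ r ])) = SU.⟨ near (Reach⇒Walk r) ⟩
    φ₁ (inj₂ _)           = SU.new-leaf

    φ₁-injective : ∀ {A B} → φ₁ A ≡ φ₁ B → A ≡ B
    φ₁-injective {inj₁ _} {inj₁ _} eq = cong inj₁ (value-injective (φ-injective (cong SU.ι eq)))
    φ₁-injective {inj₂ _} {inj₂ _} _  = refl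
    φ₁-injective {inj₁ _} {inj₂ _} ()
    φ₁-injective {inj₂ _} {inj₁ _} ()

    φ₁-label : ∀ {l A} → SideLab T u′ v′ Q l A → SideLab U u v Q l (φ₁ A)
    φ₁-label {inj₁ _} {inj₁ _} eq = φ-label eq
    φ₁-label {inj₂ _} {inj₂ _} _  = tt

    exit : Σ (List (Vert U)) λ mid → Path (Del U u v) (φ u′) u mid × (∀ {z} → z ∈ mid → z ∈ π u′ v′ u′v′)
    exit with first-crossing U._≟_ (φ u′) _ (proj₁ (π-path u′ v′ u′v′))
    ... | inj₁ avoids-uv = ⊥-elim (far (near ε ◅◅ Reach⇒Walk (_ , ImageAvoids⇒Path u′v′ avoids-uv)))
    ... | inj₂ (mid , _ , _ , _ , ch , inj₂ (reaches-v , _)) =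
      ⊥-elim (apartU (near ε ◅◅ subst (Walk (Del U u v) (φ u′)) reaches-v′ (ChainFrom⇒Walk _ mid ch)))
      where reaches-v′ = trans (End-DeleteEdge (φ u′) mid) reaches-v
    ... | inj₂ (mid , _ , _ , split , ch , inj₁ (reaches-u , _)) =
      mid , (ch , trans (End-DeleteEdge (φ u′) mid) reaches-u , Unique-++⁻ˡ (φ u′ ∷ mid) unique) , on-π
      where
      unique = subst (λ l → Unique (φ u′ ∷ l)) split (proj₂ (proj₂ (π-path u′ v′ u′v′)))
      on-π : ∀ {z} → z ∈ mid → z ∈ π u′ v′ u′v′
      on-π {z} z∈ with ∈-++⁻ (π u′ v′ u′v′) (subst (z ∈_) (sym split) (∈-++⁺ˡ z∈))
      ... | inj₁ z∈π       = z∈π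
      ... | inj₂ (here refl) = ⊥-elim (far (All.lookup (SU.ChainFrom-near (near ε) mid ch) z∈))

    private
      mid = proj₁ exit
      mid-near : All (Walk (Del U u v) u) mid
      mid-near = SU.ChainFrom-near (near ε) mid (proj₁ (proj₁ (proj₂ exit)))

      mid-on-π : ∀ {z} → z ∈ mid → z ∈ π u′ v′ u′v′
      mid-on-π = proj₂ (proj₂ exit)

      interior-near : ∀ {a b} → Walk (Del U u v) u (φ a) → (e : E (graph T) a b) → ¬ SameEdge a b u′ v′ →
                      All (Walk (Del U u v) u) (π a b e)
      interior-near {a} {b} w e ne =
        SU.ChainFrom-near w (π a b e) (proj₁ (ChainFrom-++⁻ (φ a) (π a b e) (avoids e ne)))

    -- Both orientations of the new edge use the image of e′ up to its first use of {u,v}.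
    π₁ : ∀ A B → E ST.S A B → List (V SU.S)
    π₁ (inj₁ (a , [ ra ])) (inj₁ (b , _)) (e , ne) =
      SU.lift (π a b e) (interior-near (near (Reach⇒Walk ra)) e ne)
    π₁ (inj₁ _) (inj₂ _) _ = SU.lift mid mid-near
    π₁ (inj₂ _) (inj₁ _) _ = reverse (SU.lift mid mid-near)

    private
      exit-path : ∀ .r → Path SU.S (φ₁ (inj₁ (u′ , [ r ]))) SU.new-leaf
                                (SU.lift mid mid-near ++ SU.new-leaf ∷ [])
      exit-path _ =
        Path-∷ʳ (SU.Path-ι⁻ apartU {t = SU.⟨ ε ⟩} old lifted) refl (λ leaf∈ → All.lookup old leaf∈ refl)
        where
        old = (λ ()) ∷ SU.lift-old mid mid-near
        lifted = subst (Path (Del U u v) (φ u′) u) (sym (SU.map-ι-lift mid mid-near)) (proj₁ (proj₂ exit))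

    π₁-path : ∀ A B e → Path SU.S (φ₁ A) (φ₁ B) (π₁ A B e ++ φ₁ B ∷ [])
    π₁-path (inj₁ (a , [ ra ])) (inj₁ (b , [ rb ])) (e , ne) =
      SU.Path-ι⁻ apartU ((λ ()) ∷ All.++⁺ (SU.lift-old (π a b e) _) ((λ ()) ∷ []))
        (subst (Path (Del U u v) (φ a) (φ b)) (sym lifted) (ImageAvoids⇒Path e (avoids e ne)))
      where
      lifted : map SU.ι (π₁ (inj₁ (a , [ ra ])) (inj₁ (b , [ rb ])) (e , ne) ++ φ₁ (inj₁ (b , [ rb ])) ∷ [])
             ≡ π a b e ++ φ b ∷ []
      lifted = trans (map-++ SU.ι (SU.lift (π a b e) _) _)
                     (cong (_++ φ b ∷ []) (SU.map-ι-lift (π a b e) _))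
    π₁-path (inj₁ (_ , [ r ])) (inj₂ _) refl = exit-path r
    π₁-path (inj₂ _) (inj₁ (_ , [ r ])) refl = Path-reverse SU.S-sym (exit-path r)

    private
      Shadow : V SU.S → V ST.S → V ST.S → Set
      Shadow z A B = ∃₂ λ c d → Σ (E (graph T) c d) λ e → SameEdge (ST.ι A) (ST.ι B) c d × SU.ι z ∈ π c d e

      lift-shadow : ∀ xs .{rs} {z} → z ∈ SU.lift xs rs → z ≢ SU.new-leaf × SU.ι z ∈ xs
      lift-shadow xs {rs} z∈ =
        All.lookup (SU.lift-old xs rs) z∈ , subst (_ ∈_) (SU.map-ι-lift xs rs) (∈-map⁺ SU.ι z∈)

      π₁-shadow : ∀ A B e {z} → z ∈ π₁ A B e → z ≢ SU.new-leaf × Shadow z A B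
      π₁-shadow (inj₁ (a , _)) (inj₁ (b , _)) (e , _) z∈ =
        let z-old , ιz∈ = lift-shadow (π a b e) z∈ in z-old , a , b , e , SameEdge-refl , ιz∈
      π₁-shadow (inj₁ _) (inj₂ _) refl z∈ =
        let z-old , ιz∈ = lift-shadow mid z∈ in z-old , u′ , v′ , u′v′ , SameEdge-refl , mid-on-π ιz∈
      π₁-shadow (inj₂ _) (inj₁ _) refl z∈ =
        let z-old , ιz∈ = lift-shadow mid (Any.reverse⁻ z∈)
        in z-old , u′ , v′ , u′v′ , inj₂ (refl , refl) , mid-on-π ιz∈

    π₁-avoids-φ₁ : ∀ {A B e z} → z ∈ π₁ A B e → ∀ C → φ₁ C ≢ z
    π₁-avoids-φ₁ {A} {B} {e} z∈ C φ₁C≡z with π₁-shadow A B e z∈ | C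
    ... | z-old , _              | inj₂ _       = z-old (sym φ₁C≡z)
    ... | _ , _ , _ , _ , _ , ιz∈ | inj₁ (w , _) = π-avoids-φ ιz∈ w (cong SU.ι φ₁C≡z)

    π₁-disjoint : ∀ {A B e A′ B′ e′ z} → ¬ SameEdge A B A′ B′ → z ∈ π₁ A B e → z ∈ π₁ A′ B′ e′ → ⊥
    π₁-disjoint {A} {B} {e} {A′} {B′} {e′} ne z∈ z∈′
      with π₁-shadow A B e z∈ | π₁-shadow A′ B′ e′ z∈′
    ... | _ , _ , _ , _ , s , ιz∈ | _ , _ , _ , _ , s′ , ιz∈′ =
      π-disjoint (λ same → ne (SameEdge-map⁻ (ST.ι-injective apartT)
                                (SameEdge-trans s (SameEdge-trans same (SameEdge-sym s′)))))
                 ιz∈ ιz∈′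

    restricted : Displays (Side U u v Q) (Side T u′ v′ Q)
    restricted = φ₁ , (λ _ _ → φ₁-injective) , (λ _ _ → φ₁-label) , π₁ , π₁-path
               , (λ A B e _ → π₁-avoids-φ₁ {A} {B} {e})
               , (λ A B e A′ B′ e′ _ → π₁-disjoint {A} {B} {e} {A′} {B′} {e′})

module _ {X : Set} {T U : Network X} (tree : IsTree T) {u v : Vert U} {P : X → Bool}
         (splitU : InducesSplit U u v P) (nearU : OnSideOf U u v P)
         {u′ v′ : Vert T} (splitT : InducesSplit T u′ v′ P) (nearT : OnSideOf T u′ v′ P) where
  private
    module U = NetworkFacts U
    module T = NetworkFacts T
    module SU = U.Split splitU nearU
    module ST = T.Split splitT nearT

  restrict-to-sides : Displays (Labelled U) (Labelled T) →
                      Displays (Side U u v P) (Side T u′ v′ P)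
                      × Displays (Side U v u (not ∘ P)) (Side T v′ u′ (not ∘ P))
  restrict-to-sides D =
    Restriction.restricted D P u′v′ avoids near far apartU apartT ,
    Restriction.restricted D (not ∘ P) (T.E-sym u′v′) avoids′ near′ far′ apartU′ apartT′
    where
    open Display {H = Labelled U} {G = Labelled T} D
    u′v′ = proj₁ splitT

    avoids : ∀ {a b} (e : E (graph T) a b) → ¬ SameEdge a b u′ v′ → ImageAvoids u v e
    avoids = image-avoids-cut-edge {T = T} {U = U} tree D {u} {v} {u′} {v′} splitU nearU splitT nearT

    avoids′ : ∀ {a b} (e : E (graph T) a b) → ¬ SameEdge a b v′ u′ → ImageAvoids v u e
    avoids′ e ne = ChainFrom-DeleteEdge-swap {G = graph U} _ _ (avoids e (ne ∘ SameEdge-swapʳ))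

    image : ∀ {c d} → Walk (Del T u′ v′) c d → Walk (Del U u v) (φ c) (φ d)
    image = Walk-image avoids

    to-leaf : ∀ {c x} → Walk (Del T u′ v′) c (lab T x) → Walk (Del U u v) (φ c) (lab U x)
    to-leaf w = subst (Walk _ _) (sym (φ-label refl)) (image w)

    swap : ∀ {G : Graph} {a b c d} → Walk (DeleteEdge G a b) c d → Walk (DeleteEdge G b a) c d
    swap = Walk-DeleteEdge-swap

    near : ∀ {w} → Walk (Del T u′ v′) u′ w → Walk (Del U u v) u (φ w)
    near w = SU.near-leaf ST.Px₀ ◅◅ U.Walk-reverse (to-leaf (ST.near-leaf ST.Px₀)) ◅◅ image w

    near′ : ∀ {w} → Walk (Del T v′ u′) v′ w → Walk (Del U v u) v (φ w)
    near′ w = swap (SU.far-leaf ST.Py₀ ◅◅ U.Walk-reverse (to-leaf (ST.far-leaf ST.Py₀)) ◅◅ image (swap w))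

    far : ¬ Walk (Del U u v) u (φ v′)
    far w = SU.ends-apart (w ◅◅ to-leaf (ST.far-leaf ST.Py₀)) (SU.far-leaf ST.Py₀)

    far′ : ¬ Walk (Del U v u) v (φ u′)
    far′ w = SU.ends-apart (SU.near-leaf ST.Px₀) (swap w ◅◅ to-leaf (ST.near-leaf ST.Px₀))

    apartU : ¬ Walk (Del U u v) u v
    apartU w = SU.ends-apart w ε

    apartU′ : ¬ Walk (Del U v u) v u
    apartU′ w = SU.ends-apart ε (swap w)

    apartT : ¬ Walk (Del T u′ v′) u′ v′
    apartT w = ST.ends-apart w ε

    apartT′ : ¬ Walk (Del T v′ u′) v′ u′
    apartT′ w = ST.ends-apart ε (swap w)

module SideDisplay {X : Set} {T U : Network X} {a b : Vert U} {a′ b′ : Vert T} {Q : X → Bool}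
  (D : Displays (Side U a b Q) (Side T a′ b′ Q))
  (ab : E (graph U) a b) (apart : ¬ Walk (Del U a b) a b) where
  open Display {H = Side U a b Q} {G = Side T a′ b′ Q} D public
  module SU = SideGraph U a b Q
  module ST = SideGraph T a′ b′ Q
  open SU using (ι)
  open ST using (⟨_⟩)

  φ-new-leaf : φ ST.new-leaf ≡ SU.new-leaf
  φ-new-leaf with φ ST.new-leaf | φ-label {inj₂ tt} {ST.new-leaf} tt
  ... | inj₂ _ | _  = refl
  ... | inj₁ _ | ()

  φ-old : ∀ {A} → A ≢ ST.new-leaf → φ A ≢ SU.new-leaf
  φ-old A≢ eq = A≢ (φ-injective (trans eq (sym φ-new-leaf)))

  π-old : ∀ {A B e s} → s ∈ π A B e → s ≢ SU.new-leaf
  π-old s∈ refl = π-avoids-φ s∈ ST.new-leaf φ-new-leaf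

  mapped-near : ∀ {xs z} → SU.new-leaf ∉ xs → z ∈ map ι xs → ¬ ¬ Walk (Del U a b) a z
  mapped-near leaf∉ z∈ with s , s∈ , refl ← ∈-map⁻ ι z∈ = SU.ι-near s λ { refl → leaf∉ s∈ }

  Path-ι : ∀ {s t xs} → Path SU.S s t xs → Path (graph U) (ι s) (ι t) (map ι xs)
  Path-ι = SU.Path-ι apart ab

  InSide : Vert T → Set
  InSide = Walk (Del T a′ b′) a′

  ψ : ∀ {w} → InSide w → Vert U
  ψ r = ι (φ ⟨ r ⟩)

  ψ-near : ∀ {w} (r : InSide w) → ¬ ¬ Walk (Del U a b) a (ψ r)
  ψ-near r = SU.ι-near (φ ⟨ r ⟩) (φ-old (λ ()))

  ψ-injective : ∀ {c d} (rc : InSide c) (rd : InSide d) → ψ rc ≡ ψ rd → c ≡ d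
  ψ-injective rc rd eq = cong ST.ι (φ-injective (SU.ι-injective apart eq))

  ψ-label : ∀ {x w} (qx : Q x ≡ true) (r : InSide w) → lab T x ≡ w → lab U x ≡ ψ r
  ψ-label qx r eq = SU.ι-label (φ-label {inj₁ (_ , qx)} {⟨ r ⟩} eq)

  inner-path : ∀ {c d} (rc : InSide c) (rd : InSide d) (e : E (Del T a′ b′) c d) →
               Path (graph U) (ψ rc) (ψ rd) (map ι (π ⟨ rc ⟩ ⟨ rd ⟩ e) ++ ψ rd ∷ [])
  inner-path rc rd e =
    subst (Path (graph U) (ψ rc) (ψ rd)) (map-++ ι (π ⟨ rc ⟩ ⟨ rd ⟩ e) _)
          (Path-ι (π-path ⟨ rc ⟩ ⟨ rd ⟩ e))

  exit-interior : InSide a′ → List (V SU.S)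
  exit-interior r = π ⟨ r ⟩ ST.new-leaf refl

  entry-interior : InSide a′ → List (V SU.S)
  entry-interior r = π ST.new-leaf ⟨ r ⟩ refl

  exit-path : ∀ r → Path (graph U) (ψ r) a (map ι (exit-interior r))
  exit-path r = subst (λ z → Path (graph U) (ψ r) z (map ι (exit-interior r))) (SU.into-new-leaf last-edge)
                      (Path-ι (Path-init path))
    where
    path = π-path ⟨ r ⟩ ST.new-leaf refl
    last-edge : E SU.S (End SU.S (φ ⟨ r ⟩) (exit-interior r)) SU.new-leaf
    last-edge = subst (E SU.S _) φ-new-leaf
                      (proj₁ (proj₂ (ChainFrom-++⁻ (φ ⟨ r ⟩) (exit-interior r) (proj₁ path))))

  entry-path : ∀ r → Path (graph U) b (ψ r) (map ι (entry-interior r) ++ ψ r ∷ [])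
  entry-path r = subst₂ (λ z → Path (graph U) z (ψ r)) (cong ι φ-new-leaf) (map-++ ι (entry-interior r) _)
                        (Path-ι (π-path ST.new-leaf ⟨ r ⟩ refl))

  exit-near : ∀ r {z} → z ∈ ψ r ∷ map ι (exit-interior r) → ¬ ¬ Walk (Del U a b) a z
  exit-near r = mapped-near (subst (_∉ φ ⟨ r ⟩ ∷ exit-interior r) φ-new-leaf
                                   (Path-end-∉ (π-path ⟨ r ⟩ ST.new-leaf refl)))

  entry-near : ∀ r {z} → z ∈ map ι (entry-interior r) ++ ψ r ∷ [] → ¬ ¬ Walk (Del U a b) a z
  entry-near r {z} z∈ =
    mapped-near (subst (_∉ entry-interior r ++ φ ⟨ r ⟩ ∷ []) φ-new-leaf
                       (Path-start-∉ (π-path ST.new-leaf ⟨ r ⟩ refl)))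
                (subst (z ∈_) (sym (map-++ ι (entry-interior r) _)) z∈)

  Inside : Vert U → Vert T → Vert T → Set
  Inside z c d = ∃₂ λ A B → Σ (E ST.S A B) λ e → SameEdge (ST.ι A) (ST.ι B) c d × z ∈ map ι (π A B e)

  Inside-near : ∀ {z c d} → Inside z c d → ¬ ¬ Walk (Del U a b) a z
  Inside-near (_ , _ , _ , _ , z∈) = mapped-near (λ leaf∈ → π-old leaf∈ refl) z∈

  Inside-avoids-ψ : ∀ {z c d} → Inside z c d → ∀ {w} (r : InSide w) → ψ r ≢ z
  Inside-avoids-ψ (_ , _ , _ , _ , z∈) r ψr≡z with s , s∈ , refl ← ∈-map⁻ ι z∈ =
    π-avoids-φ s∈ ⟨ r ⟩ (SU.ι-injective apart ψr≡z)

  Inside-disjoint : ∀ {z c d c′ d′} → ¬ SameEdge c d c′ d′ → Inside z c d → Inside z c′ d′ → ⊥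
  Inside-disjoint ne (_ , _ , _ , s , z∈) (A′ , B′ , e′ , s′ , z∈′)
    with t , t∈ , refl ← ∈-map⁻ ι z∈ | t′ , t∈′ , ιt≡ιt′ ← ∈-map⁻ ι z∈′ =
    π-disjoint (λ same → ne (SameEdge-trans (SameEdge-sym s) (SameEdge-trans (SameEdge-map ST.ι same) s′)))
               t∈ (subst (_∈ π A′ B′ e′) (sym (SU.ι-injective apart ιt≡ιt′)) t∈′)

module Gluing {X : Set} {T U : Network X} {u v : Vert U} {P : X → Bool}
  (splitU : InducesSplit U u v P) (nearU : OnSideOf U u v P)
  {u′ v′ : Vert T} (splitT : InducesSplit T u′ v′ P) (nearT : OnSideOf T u′ v′ P)
  (D₁ : Displays (Side U u v P) (Side T u′ v′ P))
  (D₂ : Displays (Side U v u (not ∘ P)) (Side T v′ u′ (not ∘ P))) where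
  private
    module U = NetworkFacts U
    module T = NetworkFacts T
    module SU = U.Split splitU nearU
    module ST = T.Split splitT nearT
    swap : ∀ {G : Graph} {a b c d} → Walk (DeleteEdge G a b) c d → Walk (DeleteEdge G b a) c d
    swap = Walk-DeleteEdge-swap
    module S₁ = SideDisplay D₁ (proj₁ splitU) (λ w → SU.ends-apart w ε)
    module S₂ = SideDisplay D₂ (U.E-sym (proj₁ splitU)) (λ w → SU.ends-apart ε (swap w))

    true≢false : true ≢ false
    true≢false ()

    separated : ∀ {z} → ¬ ¬ Walk (Del U u v) u z → ¬ ¬ Walk (Del U v u) v z → ⊥
    separated near far = near λ w → far λ w′ → SU.ends-apart w (swap w′)

  Reached : Vert T → Set
  Reached w = Walk (Del T u′ v′) u′ w ⊎ Walk (Del T u′ v′) v′ w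

  ψ : ∀ {w} → Reached w → Vert U
  ψ (inj₁ r) = S₁.ψ r
  ψ (inj₂ r) = S₂.ψ (swap r)

  ψ-injective : ∀ {c d} (rc : Reached c) (rd : Reached d) → ψ rc ≡ ψ rd → c ≡ d
  ψ-injective (inj₁ rc) (inj₁ rd) eq = S₁.ψ-injective rc rd eq
  ψ-injective (inj₂ rc) (inj₂ rd) eq = S₂.ψ-injective (swap rc) (swap rd) eq
  ψ-injective (inj₁ rc) (inj₂ rd) eq =
    ⊥-elim (separated (S₁.ψ-near rc) (subst (¬_ ∘ ¬_ ∘ Walk (Del U v u) v) (sym eq) (S₂.ψ-near (swap rd))))
  ψ-injective (inj₂ rc) (inj₁ rd) eq =
    ⊥-elim (separated (S₁.ψ-near rd) (subst (¬_ ∘ ¬_ ∘ Walk (Del U v u) v) eq (S₂.ψ-near (swap rc))))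

  ψ-label : ∀ {x w} (r : Reached w) → lab T x ≡ w → lab U x ≡ ψ r
  ψ-label {x} r refl with P x in px | r
  ... | true  | inj₁ r₁ = S₁.ψ-label px r₁ refl
  ... | false | inj₂ r₂ = S₂.ψ-label (cong not px) (swap r₂) refl
  ... | true  | inj₂ r₂ = ⊥-elim (true≢false (trans (sym px) (ST.far⇒false r₂)))
  ... | false | inj₁ r₁ = ⊥-elim (true≢false (trans (sym (ST.near⇒true r₁)) px))


  data Placement : ∀ {a b} → Reached a → Reached b → Set where
    inside₁ : ∀ {a b} {ra : Walk (Del T u′ v′) u′ a} {rb : Walk (Del T u′ v′) u′ b} →
              E (Del T u′ v′) a b → Placement (inj₁ ra) (inj₁ rb)
    inside₂ : ∀ {a b} {ra : Walk (Del T u′ v′) v′ a} {rb : Walk (Del T u′ v′) v′ b} →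
              E (Del T v′ u′) a b → Placement (inj₂ ra) (inj₂ rb)
    across  : ∀ {ra : Walk (Del T u′ v′) u′ u′} {rb : Walk (Del T u′ v′) v′ v′} →
              Placement (inj₁ ra) (inj₂ rb)
    across′ : ∀ {ra : Walk (Del T u′ v′) v′ v′} {rb : Walk (Del T u′ v′) u′ u′} →
              Placement (inj₂ ra) (inj₁ rb)

  placement : ∀ {a b} → E (graph T) a b → (ra : Reached a) (rb : Reached b) → Placement ra rb
  placement e (inj₁ ra) (inj₁ rb) =
    inside₁ (e , λ { (inj₁ (_ , refl)) → ST.ends-apart rb ε ; (inj₂ (refl , _)) → ST.ends-apart ra ε })
  placement e (inj₂ ra) (inj₂ rb) =
    inside₂ (e , λ { (inj₁ (_ , refl)) → ST.ends-apart ε rb ; (inj₂ (refl , _)) → ST.ends-apart ε ra })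
  placement {a} {b} e (inj₁ ra) (inj₂ rb) with SameEdge-dec T._≟_ a b u′ v′
  ... | yes (inj₁ (refl , refl)) = across
  ... | yes (inj₂ (refl , refl)) = ⊥-elim (ST.ends-apart ra ε)
  ... | no ne                    = ⊥-elim (ST.ends-apart (ra ◅◅ (e , ne) ◅ ε) rb)
  placement {a} {b} e (inj₂ ra) (inj₁ rb) with SameEdge-dec T._≟_ a b u′ v′
  ... | yes (inj₂ (refl , refl)) = across′
  ... | yes (inj₁ (refl , refl)) = ⊥-elim (ST.ends-apart ε ra)
  ... | no ne                    = ⊥-elim (ST.ends-apart rb (ra ◅◅ (e , ne) ◅ ε))

  interior : ∀ {a b} {ra : Reached a} {rb : Reached b} → Placement ra rb → List (Vert U)
  interior (inside₁ {ra = ra} {rb} e) = map S₁.SU.ι (S₁.π S₁.ST.⟨ ra ⟩ S₁.ST.⟨ rb ⟩ e)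
  interior (inside₂ {ra = ra} {rb} e) = map S₂.SU.ι (S₂.π S₂.ST.⟨ swap ra ⟩ S₂.ST.⟨ swap rb ⟩ e)
  interior (across {ra} {rb})  =
    map S₁.SU.ι (S₁.exit-interior ra) ++ map S₂.SU.ι (S₂.entry-interior (swap rb))
  interior (across′ {ra} {rb}) =
    map S₂.SU.ι (S₂.exit-interior (swap ra)) ++ map S₁.SU.ι (S₁.entry-interior rb)

  private
    bridge : ∀ {p q m xs ys} → Path (graph U) p m xs → Path (graph U) m q (ys ++ q ∷ []) →
             Disjoint (p ∷ xs) (ys ++ q ∷ []) → Path (graph U) p q ((xs ++ ys) ++ q ∷ [])
    bridge {q = q} {xs = xs} {ys} P₁ P₂ disj =
      subst (Path (graph U) _ q) (sym (++-assoc xs ys (q ∷ []))) (Path-join P₁ P₂ disj)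

  placement-path : ∀ {a b} {ra : Reached a} {rb : Reached b} (p : Placement ra rb) →
                   Path (graph U) (ψ ra) (ψ rb) (interior p ++ ψ rb ∷ [])
  placement-path (inside₁ {ra = ra} {rb} e) = S₁.inner-path ra rb e
  placement-path (inside₂ {ra = ra} {rb} e) = S₂.inner-path (swap ra) (swap rb) e
  placement-path (across {ra} {rb}) =
    bridge (S₁.exit-path ra) (S₂.entry-path (swap rb))
           λ (z∈₁ , z∈₂) → separated (S₁.exit-near ra z∈₁) (S₂.entry-near (swap rb) z∈₂)
  placement-path (across′ {ra} {rb}) =
    bridge (S₂.exit-path (swap ra)) (S₁.entry-path rb)
           λ (z∈₂ , z∈₁) → separated (S₁.entry-near rb z∈₁) (S₂.exit-near (swap ra) z∈₂)

  Inside : Vert U → Vert T → Vert T → Set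
  Inside z c d = S₁.Inside z c d ⊎ S₂.Inside z c d

  interior-inside : ∀ {a b} {ra : Reached a} {rb : Reached b} (p : Placement ra rb) {z} →
                    z ∈ interior p → Inside z a b
  interior-inside (inside₁ {ra = ra} {rb} e) z∈ =
    inj₁ (S₁.ST.⟨ ra ⟩ , S₁.ST.⟨ rb ⟩ , e , SameEdge-refl , z∈)
  interior-inside (inside₂ {ra = ra} {rb} e) z∈ =
    inj₂ (S₂.ST.⟨ swap ra ⟩ , S₂.ST.⟨ swap rb ⟩ , e , SameEdge-refl , z∈)
  interior-inside (across {ra} {rb}) z∈ with ∈-++⁻ (map S₁.SU.ι (S₁.exit-interior ra)) z∈
  ... | inj₁ z∈₁ = inj₁ (S₁.ST.⟨ ra ⟩ , S₁.ST.new-leaf , refl , SameEdge-refl , z∈₁)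
  ... | inj₂ z∈₂ = inj₂ (S₂.ST.new-leaf , S₂.ST.⟨ swap rb ⟩ , refl , SameEdge-refl , z∈₂)
  interior-inside (across′ {ra} {rb}) z∈ with ∈-++⁻ (map S₂.SU.ι (S₂.exit-interior (swap ra))) z∈
  ... | inj₁ z∈₂ = inj₂ (S₂.ST.⟨ swap ra ⟩ , S₂.ST.new-leaf , refl , SameEdge-refl , z∈₂)
  ... | inj₂ z∈₁ = inj₁ (S₁.ST.new-leaf , S₁.ST.⟨ rb ⟩ , refl , SameEdge-refl , z∈₁)

  Inside-avoids-ψ : ∀ {z c d} → Inside z c d → ∀ {w} (r : Reached w) → ψ r ≢ z
  Inside-avoids-ψ (inj₁ i) (inj₁ r)      = S₁.Inside-avoids-ψ i r
  Inside-avoids-ψ (inj₂ i) (inj₂ r)      = S₂.Inside-avoids-ψ i (swap r)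
  Inside-avoids-ψ (inj₁ i) (inj₂ r) refl = separated (S₁.Inside-near i) (S₂.ψ-near (swap r))
  Inside-avoids-ψ (inj₂ i) (inj₁ r) refl = separated (S₁.ψ-near r) (S₂.Inside-near i)

  Inside-disjoint : ∀ {z c d c′ d′} → ¬ SameEdge c d c′ d′ → Inside z c d → Inside z c′ d′ → ⊥
  Inside-disjoint ne (inj₁ i) (inj₁ i′) = S₁.Inside-disjoint ne i i′
  Inside-disjoint ne (inj₂ i) (inj₂ i′) = S₂.Inside-disjoint ne i i′
  Inside-disjoint _  (inj₁ i) (inj₂ i′) = separated (S₁.Inside-near i) (S₂.Inside-near i′)
  Inside-disjoint _  (inj₂ i) (inj₁ i′) = separated (S₁.Inside-near i′) (S₂.Inside-near i)

  glued : Displays (Labelled U) (Labelled T)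
  glued = (λ w → ψ (reached w))
        , (λ a b → ψ-injective (reached a) (reached b))
        , (λ x w → ψ-label (reached w))
        , (λ a b e → interior (placed e))
        , (λ a b e → placement-path (placed e))
        , (λ a b e z z∈ c → Inside-avoids-ψ (interior-inside (placed e) z∈) (reached c))
        , (λ a b e c d e′ z ne z∈ z∈′ →
             Inside-disjoint ne (interior-inside (placed e) z∈) (interior-inside (placed e′) z∈′))
    where
    reached : ∀ w → Reached w
    reached = T.reached-from-an-end u′ v′
    placed : ∀ {a b} → E (graph T) a b → Placement (reached a) (reached b)
    placed e = placement e (reached _) (reached _)

lemma6 : {X : Set} → Finite X → X →
    (T U : Network X) → IsTree T → ThreeCuttable U → ¬ IsSimple U →
    (u v : Vert U) → NonTrivialCutEdge U u v →
    (P : X → Bool) → InducesSplit U u v P → OnSideOf U u v P →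
    (u′ v′ : Vert T) → InducesSplit T u′ v′ P → OnSideOf T u′ v′ P →
    Displays (Labelled U) (Labelled T)
      ⇔ (Displays (Side U u v P) (Side T u′ v′ P)
         × Displays (Side U v u (not ∘ P)) (Side T v′ u′ (not ∘ P)))
lemma6 _ _ T U tree _ _ u v _ P splitU nearU u′ v′ splitT nearT =
  mk⇔ (restrict-to-sides tree splitU nearU splitT nearT)
      (λ (D₁ , D₂) → Gluing.glued splitU nearU splitT nearT D₁ D₂)
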